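{- For all integers $r \ge 3$ and $s$ with $3 \le s \le 2r$, there exists an $r$-uniform linear hypertree $H$ with $\Delta(H) = s$ and $\hat{n}(H) = 0$.
   Context: All hypergraphs are simple (if $e \subseteq e'$ for hyperedges $e,e'$ then $e=e'$) and have no loops. A hypergraph is $r$-uniform if every hyperedge has exactly $r$ vertices. The degree of a vertex is the number of hyperedges containing it, and $\Delta(H)$ is the maximum degree. A hypergraph is linear if $|e \cap e'| \le 1$ for all distinct hyperedges $e, e'$. A hypergraph $H$ is a hypertree if there is a (graph) tree $T$ with $V(T) = V(H)$ such that for every hyperedge $e$ the induced subgraph $T[e]$ is connected. Digraphs have no pair of opposite arcs; a digraph is acyclic if it contains no directed cycle. For a digraph $D$, $N^-_D(v)=\{u:(u,v)\in A(D)\}$ and $N^+_D(v)=\{u:(v,u)\in A(D)\}$. The niche hypergraph $NH(D)$ of a digraph $D$ has vertex set $V(D)$ and hyperedge set $\{e \subseteq V(D): |e| \ge 2 \text{ and } e = N^-_D(v) \text{ or } e = N^+_D(v) \text{ for some } v \in V(D)\}$. For a hypergraph $H$, the niche number $\hat{n}(H)$ is the minimum $k \ge 0$ such that $H$ together with $k$ additional isolated vertices is the niche hypergraph of an acyclic digraph ($\hat{n}(H)=\infty$ if no such $k$ exists). -}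

module Defs where

open import Data.Nat using (ℕ; zero; suc; _+_; _≤_; _≥_; _⊔_)
open import Data.Fin using (Fin; zero; suc; inject₁; fromℕ)
open import Data.Fin.Subset using (Subset; _∈_; _⊆_; _∩_; ∣_∣)
open import Data.Fin.Subset.Properties using (_∈?_)
open import Data.Bool using (Bool; true; false)
open import Data.List using (List; length; filter; map; foldr)
open import Data.List.Base using (allFin)
import Data.List.Membership.Propositional as LM
open import Data.List.Relation.Unary.Unique.Propositional using (Unique)
open import Data.Vec using (Vec; tabulate; replicate; _++_)
open import Data.Product using (Σ; ∃; ∃-syntax; _×_; _,_)
open import Data.Sum using (_⊎_)
open import Relation.Binary.PropositionalEquality using (_≡_; _≢_)
open import Relation.Binary.Construct.Closure.ReflexiveTransitive using (Star)
open import Relation.Binary.Construct.Closure.Transitive using (TransClosure)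
open import Relation.Nullary using (¬_)
open import Function using (_⇔_)
open import Function.Definitions using (Injective)

-- Hypergraphs on vertex set Fin n, hyperedges = a duplicate-free list
-- of subsets (read as a finite set of hyperedges).

record Hypergraph : Set where
  field
    n      : ℕ
    edges  : List (Subset n)
    nodup  : Unique edges
    simple : ∀ {e e'} → e LM.∈ edges → e' LM.∈ edges → e ⊆ e' → e ≡ e'
    noLoop : ∀ {e} → e LM.∈ edges → ∣ e ∣ ≥ 2
open Hypergraph public

Uniform : ℕ → Hypergraph → Set
Uniform r H = ∀ {e} → e LM.∈ edges H → ∣ e ∣ ≡ r

Linear : Hypergraph → Set
Linear H = ∀ {e e'} → e LM.∈ edges H → e' LM.∈ edges H → e ≢ e' →
           ∣ e ∩ e' ∣ ≤ 1

degree : (H : Hypergraph) → Fin (n H) → ℕ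
degree H v = length (filter (v ∈?_) (edges H))

-- Δ(H): maximum degree (0 for the empty vertex set)
maxDegree : Hypergraph → ℕ
maxDegree H = foldr _⊔_ 0 (map (degree H) (allFin (n H)))

record Graph (m : ℕ) : Set where
  field
    adj     : Fin m → Fin m → Bool
    symm    : ∀ u v → adj u v ≡ adj v u
    irrefl  : ∀ u → adj u u ≡ false
open Graph public

Adj : ∀ {m} → Graph m → Fin m → Fin m → Set
Adj G u v = adj G u v ≡ true

Connected : ∀ {m} → Graph m → Set
Connected G = ∀ u v → Star (Adj G) u v

HasCycle : ∀ {m} → Graph m → Set
HasCycle {m} G =
  ∃[ k ] Σ (Fin (suc (suc (suc k))) → Fin m) λ c →
    Injective _≡_ _≡_ c ×
    (∀ (i : Fin (suc (suc k))) → Adj G (c (inject₁ i)) (c (suc i))) ×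
    Adj G (c (fromℕ (suc (suc k)))) (c zero)

IsTree : ∀ {m} → Graph m → Set
IsTree G = Connected G × ¬ HasCycle G

InducedAdj : ∀ {m} → Graph m → Subset m → Fin m → Fin m → Set
InducedAdj G e u v = u ∈ e × v ∈ e × Adj G u v

InducedConnected : ∀ {m} → Graph m → Subset m → Set
InducedConnected G e = ∀ u v → u ∈ e → v ∈ e → Star (InducedAdj G e) u v

IsHypertree : Hypergraph → Set
IsHypertree H = Σ (Graph (n H)) λ T →
  IsTree T × (∀ {e} → e LM.∈ edges H → InducedConnected T e)

record Digraph (m : ℕ) : Set where
  field
    arc          : Fin m → Fin m → Bool
    noOpposite   : ∀ u v → arc u v ≡ true → arc v u ≡ false
open Digraph public

Arc : ∀ {m} → Digraph m → Fin m → Fin m → Set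
Arc D u v = arc D u v ≡ true

Acyclic : ∀ {m} → Digraph m → Set
Acyclic D = ∀ v → ¬ TransClosure (Arc D) v v

inNbhd : ∀ {m} → Digraph m → Fin m → Subset m
inNbhd D v = tabulate (λ u → arc D u v)

outNbhd : ∀ {m} → Digraph m → Fin m → Subset m
outNbhd D v = tabulate (λ u → arc D v u)

NicheEdge : ∀ {m} → Digraph m → Subset m → Set
NicheEdge D e = ∣ e ∣ ≥ 2 × ∃[ v ] (e ≡ inNbhd D v ⊎ e ≡ outNbhd D v)

-- H together with k isolated vertices is the niche hypergraph of an
-- acyclic digraph (vertex set Fin (n + k); hyperedges of H padded).
NicheRealizable : Hypergraph → ℕ → Set
NicheRealizable H k = Σ (Digraph (n H + k)) λ D →
  Acyclic D ×
  (∀ (e : Subset (n H + k)) →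
     (∃[ e₀ ] (e₀ LM.∈ edges H × e ≡ e₀ ++ replicate k false)) ⇔ NicheEdge D e)

-- n̂(H) = 0 : the least admissible k is 0, i.e. k = 0 is admissible
NicheNumberZero : Hypergraph → Set
NicheNumberZero H = NicheRealizable H 0

module Submission where

-- Write r = k + 1.  The vertices are 0 (the centre), a left side L = {1, …, r}, a right
-- side R = {r+1, …, 2r} and s disjoint blocks B₀, …, B_{s-1} of k vertices each.  The
-- hyperedges are L, R and the petals S_t = {0} ∪ B_t (t < s).  Distinct hyperedges meet
-- at most in 0, so H is simple, linear and r-uniform, the centre has degree s and every
-- other vertex degree 1.  The tree joins 2, …, r to 1, the rest of R to r+1, and all
-- other vertices to 0; each hyperedge is a star of it around 1, r+1 or 0.  The digraph D
-- has the arcs a → x (a ∈ L, x ∈ S_{a-1}) and x → b (b ∈ R, x ∈ S_{b-1}).  It is acyclic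
-- (arcs go L → middle → R), in(0) = L, out(0) = R, the petal S_t is out(t+1) or in(t+1)
-- as t+1 ≤ s ≤ 2r lies in L or R, and every other neighbourhood has at most one vertex.

open import Defs
open import Level using (0ℓ)
open import Function using (_⇔_; mk⇔; Equivalence; _∘_; id)
open import Data.Empty using (⊥; ⊥-elim)
open import Data.Bool using (Bool; true; false; _∨_; if_then_else_)
import Data.Bool.Properties as Bool
open import Data.Product using (Σ; ∃-syntax; _×_; _,_; proj₂)
open import Data.Sum using (_⊎_; inj₁; inj₂)
import Data.Sum as Sum
open import Data.Nat using (ℕ; zero; suc; pred; _+_; _*_; _∸_; _≤_; _<_; z≤n; s≤s; s≤s⁻¹; _⊔_; _≤?_; _<?_; _≟_)
open import Data.Nat.Properties
open import Data.Fin using (Fin; zero; suc; toℕ; fromℕ<; inject₁; fromℕ; lower₁)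
open import Data.Fin.Properties using (toℕ-injective; toℕ-fromℕ<)
import Data.Fin.Properties as Fin
open import Data.Fin.Subset using (Subset; _∈_; _⊆_; _∩_; ∣_∣; inside; outside; Empty)
open import Data.Fin.Subset.Properties using (Empty-unique; ∣⊥∣≡0; x∈p∩q⁻; _∈?_)
open import Data.Vec using ([]; _∷_; tabulate; _++_; replicate)
import Data.Vec as Vec
open import Data.Vec.Properties using ([]=⇒lookup; lookup⇒[]=; lookup∘tabulate; tabulate-cong)
open import Data.List using (List; []; _∷_; allFin; map; filter; length)
open import Data.List.Properties
  using (filter-none; filter-reject; filter-all; length-map; length-tabulate; foldr-preservesᵇ; foldr-preservesᵒ)
import Data.List.Membership.Propositional as LM
open import Data.List.Membership.Propositional.Properties using (∈-allFin; ∈-map⁻; ∈-map⁺)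
open import Data.List.Relation.Unary.Any using (here; there)
import Data.List.Relation.Unary.Any as Any
import Data.List.Relation.Unary.Any.Properties as Any
import Data.List.Relation.Unary.All as All
import Data.List.Relation.Unary.All.Properties as All
open import Data.List.Relation.Unary.AllPairs using (AllPairs; []; _∷_)
import Data.List.Relation.Unary.AllPairs as AllPairs
import Data.List.Relation.Unary.AllPairs.Properties as AllPairs
open import Data.List.Relation.Unary.Unique.Propositional using (Unique)
import Data.List.Relation.Unary.Unique.Propositional.Properties as Unique
open import Data.List.Extrema.Nat using (argmax; f[xs]≤f[argmax])
open import Relation.Nullary using (¬_; Dec; yes; no; does; contradiction; ¬?)
open import Relation.Nullary.Decidable using (dec-true; dec-false; does-⇔; _×-dec_; _⊎-dec_)
open import Relation.Unary using (Pred; Decidable)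
open import Relation.Binary.Definitions using (DecidableEquality; tri<; tri≈; tri>)
open import Relation.Binary.PropositionalEquality
open import Relation.Binary.Construct.Closure.Transitive using (TransClosure; [_]; _∷_)
open import Relation.Binary.Construct.Closure.ReflexiveTransitive using (Star; ε; _◅_; _◅◅_)
import Relation.Binary.Construct.Closure.ReflexiveTransitive as Star

∨-true : ∀ x {y} → x ∨ y ≡ true → x ≡ true ⊎ y ≡ true
∨-true true  _   = inj₁ refl
∨-true false y≡t = inj₂ y≡t

does-true⇒ : ∀ {A : Set} (A? : Dec A) → does A? ≡ true → A
does-true⇒ (yes a) _ = a

subsetOf : ∀ n {P : Pred ℕ 0ℓ} → Decidable P → Subset n
subsetOf n P? = tabulate (λ i → does (P? (toℕ i)))

module _ {P : Pred ℕ 0ℓ} (P? : Decidable P) {n : ℕ} where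

  ∈subsetOf⁺ : ∀ {i : Fin n} → P (toℕ i) → i ∈ subsetOf n P?
  ∈subsetOf⁺ {i} p = lookup⇒[]= i _ (trans (lookup∘tabulate _ i) (dec-true (P? (toℕ i)) p))

  ∈subsetOf⁻ : ∀ {i : Fin n} → i ∈ subsetOf n P? → P (toℕ i)
  ∈subsetOf⁻ {i} i∈ = does-true⇒ (P? (toℕ i)) (trans (sym (lookup∘tabulate _ i)) ([]=⇒lookup i∈))

subsetOf-cong : ∀ n {P Q : Pred ℕ 0ℓ} (P? : Decidable P) (Q? : Decidable Q) →
                (∀ x → P x ⇔ Q x) → subsetOf n P? ≡ subsetOf n Q?
subsetOf-cong n P? Q? P⇔Q = tabulate-cong (λ i → does-⇔ (P⇔Q (toℕ i)) (P? (toℕ i)) (Q? (toℕ i)))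

pad : ∀ {m} → Subset m → Subset (m + 0)
pad e = e ++ replicate 0 false

subsetOf-pad : ∀ n {P : Pred ℕ 0ℓ} (P? : Decidable P) → pad (subsetOf n P?) ≡ subsetOf (n + 0) P?
subsetOf-pad zero    P? = refl
subsetOf-pad (suc n) P? = cong (does (P? 0) ∷_) (subsetOf-pad n (λ x → P? (suc x)))

∣p∣≤1 : ∀ {n} (p : Subset n) → (∀ {i j} → i ∈ p → j ∈ p → i ≡ j) → ∣ p ∣ ≤ 1
∣p∣≤1 []            _    = z≤n
∣p∣≤1 (outside ∷ p) same = ∣p∣≤1 p (λ i∈ j∈ → Fin.suc-injective (same (Vec.there i∈) (Vec.there j∈)))
∣p∣≤1 {suc n} (inside ∷ p) same = s≤s (≤-reflexive (trans (cong ∣_∣ (Empty-unique noOther)) (∣⊥∣≡0 n)))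
  where
  noOther : Empty p
  noOther (i , i∈) with same Vec.here (Vec.there i∈)
  ... | ()

module _ {P : Pred ℕ 0ℓ} (P? : Decidable P) (n : ℕ) where

  ∣subsetOf∣-yes : P 0 → ∣ subsetOf (suc n) P? ∣ ≡ suc ∣ subsetOf n (λ x → P? (suc x)) ∣
  ∣subsetOf∣-yes p rewrite dec-true (P? 0) p = refl

  ∣subsetOf∣-no : ¬ P 0 → ∣ subsetOf (suc n) P? ∣ ≡ ∣ subsetOf n (λ x → P? (suc x)) ∣
  ∣subsetOf∣-no ¬p rewrite dec-false (P? 0) ¬p = refl

In : ℕ → ℕ → Pred ℕ 0ℓ
In lo len x = lo ≤ x × x < lo + len

in? : ∀ lo len → Decidable (In lo len)
in? lo len x = lo ≤? x ×-dec x <? lo + len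

In-suc : ∀ {lo len x} → In (suc lo) len (suc x) ⇔ In lo len x
In-suc = mk⇔ (λ (lo≤x , x<) → s≤s⁻¹ lo≤x , s≤s⁻¹ x<) (λ (lo≤x , x<) → s≤s lo≤x , s≤s x<)

In-zero-suc : ∀ {len x} → In 0 (suc len) (suc x) ⇔ In 0 len x
In-zero-suc = mk⇔ (λ (_ , x<) → z≤n , s≤s⁻¹ x<) (λ (_ , x<) → z≤n , s≤s x<)

In-positive : ∀ {lo len x} → In (suc lo) len x → x ≢ 0
In-positive (s≤s _ , _) ()

In-disjoint : ∀ {lo len lo′ len′ x} → lo + len ≤ lo′ → In lo len x → ¬ In lo′ len′ x
In-disjoint le (_ , x<) (lo′≤x , _) = <⇒≱ (<-≤-trans x< le) lo′≤x

block-of : ∀ k s {y} → y < s * k → ∃[ t ] (t < s × In (t * k) k y)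
block-of k zero    ()
block-of k (suc s) {y} y<sk with y <? s * k
... | yes y<s′k = let (t , t<s , y∈) = block-of k s y<s′k in t , m<n⇒m<1+n t<s , y∈
... | no  y≮s′k = s , ≤-refl , ≮⇒≥ y≮s′k , subst (y <_) (+-comm k (s * k)) y<sk

∣interval∣ : ∀ n lo len → lo + len ≤ n → ∣ subsetOf n (in? lo len) ∣ ≡ len
∣interval∣ zero    lo       len le = sym (n≤0⇒n≡0 (m+n≤o⇒n≤o lo le))
∣interval∣ (suc n) (suc lo) len le = begin
  ∣ subsetOf (suc n) (in? (suc lo) len) ∣
    ≡⟨ ∣subsetOf∣-no (in? (suc lo) len) n (λ (lo<0 , _) → contradiction lo<0 λ ()) ⟩
  ∣ subsetOf n (λ x → in? (suc lo) len (suc x)) ∣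
    ≡⟨ cong ∣_∣ (subsetOf-cong n (λ x → in? (suc lo) len (suc x)) (in? lo len) (λ _ → In-suc)) ⟩
  ∣ subsetOf n (in? lo len) ∣
    ≡⟨ ∣interval∣ n lo len (s≤s⁻¹ le) ⟩
  len ∎
  where open ≡-Reasoning
∣interval∣ (suc n) zero (suc len) le = begin
  ∣ subsetOf (suc n) (in? 0 (suc len)) ∣
    ≡⟨ ∣subsetOf∣-yes (in? 0 (suc len)) n (z≤n , s≤s z≤n) ⟩
  suc ∣ subsetOf n (λ x → in? 0 (suc len) (suc x)) ∣
    ≡⟨ cong (suc ∘ ∣_∣) (subsetOf-cong n (λ x → in? 0 (suc len) (suc x)) (in? 0 len) (λ _ → In-zero-suc)) ⟩
  suc ∣ subsetOf n (in? 0 len) ∣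
    ≡⟨ cong suc (∣interval∣ n 0 len (s≤s⁻¹ le)) ⟩
  suc len ∎
  where open ≡-Reasoning
∣interval∣ (suc n) zero zero le =
  trans (cong ∣_∣ (Empty-unique {p = subsetOf (suc n) (in? 0 0)} nothing)) (∣⊥∣≡0 (suc n))
  where
  nothing : Empty (subsetOf (suc n) (in? 0 0))
  nothing (i , i∈) = n≮0 (proj₂ (∈subsetOf⁻ (in? 0 0) i∈))

∣subsetOf∣≤1 : ∀ n {P : Pred ℕ 0ℓ} (P? : Decidable P) {c} → (∀ {x} → P x → x ≡ c) →
               ∣ subsetOf n P? ∣ ≤ 1
∣subsetOf∣≤1 n P? only = ∣p∣≤1 (subsetOf n P?) λ i∈ j∈ →
  toℕ-injective (trans (only (∈subsetOf⁻ P? i∈)) (sym (only (∈subsetOf⁻ P? j∈))))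

module Ranked {m} (arcᵇ : Fin m → Fin m → Bool) (rank : Fin m → ℕ)
                  (rank-up : ∀ {u v} → arcᵇ u v ≡ true → rank u < rank v) where

  digraph : Digraph m
  digraph = record
    { arc        = arcᵇ
    ; noOpposite = λ u v uv → Bool.¬-not λ vu → <-asym (rank-up uv) (rank-up vu) }

  acyclic : Acyclic digraph
  acyclic v cycle = <-irrefl refl (rank-up⁺ cycle)
    where
    rank-up⁺ : ∀ {u w} → TransClosure (Arc digraph) u w → rank u < rank w
    rank-up⁺ [ uw ]      = rank-up uw
    rank-up⁺ (uv ∷ path) = <-trans (rank-up uv) (rank-up⁺ path)

∣pad∣ : ∀ {m} (e : Subset m) → ∣ pad e ∣ ≡ ∣ e ∣
∣pad∣ []            = refl
∣pad∣ (outside ∷ e) = ∣pad∣ e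
∣pad∣ (inside ∷ e)  = cong suc (∣pad∣ e)

-- A neighbourhood of D is harmless for H when it is too small to be a niche hyperedge
-- or it is a hyperedge of H.
Harmless : (H : Hypergraph) → Subset (n H + 0) → Set
Harmless H e = ∣ e ∣ ≤ 1 ⊎ ∃[ e₀ ] (e₀ LM.∈ edges H × e ≡ pad e₀)

nicheNumberZero-intro : (H : Hypergraph) (D : Digraph (n H + 0)) → Acyclic D →
  (∀ v → Harmless H (inNbhd D v)) → (∀ v → Harmless H (outNbhd D v)) →
  (∀ {e₀} → e₀ LM.∈ edges H → ∃[ v ] (pad e₀ ≡ inNbhd D v ⊎ pad e₀ ≡ outNbhd D v)) →
  NicheNumberZero H
nicheNumberZero-intro H D acyclic in-harmless out-harmless realised =
  D , acyclic , λ e → mk⇔ (edge⇒niche e) (niche⇒edge e)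
  where
  edge⇒niche : ∀ e → ∃[ e₀ ] (e₀ LM.∈ edges H × e ≡ pad e₀) → NicheEdge D e
  edge⇒niche e (e₀ , e₀∈ , refl) =
    subst (2 ≤_) (sym (∣pad∣ e₀)) (noLoop H e₀∈) , realised e₀∈

  harmless⇒edge : ∀ {e} → 2 ≤ ∣ e ∣ → Harmless H e → ∃[ e₀ ] (e₀ LM.∈ edges H × e ≡ pad e₀)
  harmless⇒edge 2≤∣e∣ (inj₁ ∣e∣≤1) = contradiction (≤-trans 2≤∣e∣ ∣e∣≤1) λ { (s≤s ()) }
  harmless⇒edge _     (inj₂ edge)  = edge

  niche⇒edge : ∀ e → NicheEdge D e → ∃[ e₀ ] (e₀ LM.∈ edges H × e ≡ pad e₀)
  niche⇒edge e (2≤∣e∣ , v , inj₁ refl) = harmless⇒edge 2≤∣e∣ (in-harmless v)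
  niche⇒edge e (2≤∣e∣ , v , inj₂ refl) = harmless⇒edge 2≤∣e∣ (out-harmless v)

module _ {m} (G : Graph m) where

  Adj-sym : ∀ {u v} → Adj G u v → Adj G v u
  Adj-sym {u} {v} uv = trans (symm G v u) uv

  cycle-neighbours : ∀ {k} (c : Fin (suc (suc (suc k))) → Fin m) →
    (∀ i → Adj G (c (inject₁ i)) (c (suc i))) → Adj G (c (fromℕ (suc (suc k)))) (c zero) →
    ∀ j → ∃[ a ] ∃[ b ] (a ≢ b × Adj G (c j) (c a) × Adj G (c j) (c b))
  cycle-neighbours c chain close zero =
    suc zero , fromℕ _ , (λ ()) , chain zero , Adj-sym close
  cycle-neighbours {k} c chain close (suc i) with suc k ≟ toℕ i
  ... | yes i-last
    rewrite toℕ-injective {i = i} {j = fromℕ (suc k)} (trans (sym i-last) (sym (Fin.toℕ-fromℕ (suc k)))) =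
    inject₁ (fromℕ (suc k)) , zero , (λ ()) , Adj-sym (chain (fromℕ (suc k))) , close
  ... | no ¬i-last =
    inject₁ i , suc (suc i′) , i≢i′+2 , Adj-sym (chain i) ,
    subst (λ x → Adj G (c (suc x)) (c (suc (suc i′)))) (Fin.inject₁-lower₁ i ¬i-last) (chain (suc i′))
    where
    i′ = lower₁ i ¬i-last
    i≢i′+2 : inject₁ i ≢ suc (suc i′)
    i≢i′+2 eq = contradiction (begin
      toℕ i                 ≡⟨ Fin.toℕ-inject₁ i ⟨
      toℕ (inject₁ i)       ≡⟨ cong toℕ eq ⟩
      suc (suc (toℕ i′))    ≡⟨ cong (λ x → suc (suc x)) (Fin.toℕ-lower₁ i ¬i-last) ⟩
      suc (suc (toℕ i)) ∎) (<⇒≢ (s≤s (n≤1+n (toℕ i))))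
      where open ≡-Reasoning

deepest-position : ∀ {n} (f : Fin (suc n) → ℕ) → ∃[ j ] (∀ i → f i ≤ f j)
deepest-position {n} f =
  argmax f zero (allFin _) , λ i → All.lookup (f[xs]≤f[argmax] {f = f} zero (allFin _)) (∈-allFin i)

module ParentTree {m} (root : Fin m) (parent : Fin m → Fin m) (depth : Fin m → ℕ)
                  (parent-shallower : ∀ {v} → v ≢ root → depth (parent v) < depth v) where

  ChildOf : Fin m → Fin m → Set
  ChildOf u v = u ≢ root × parent u ≡ v

  childOf? : ∀ u v → Dec (ChildOf u v)
  childOf? u v = ¬? (u Fin.≟ root) ×-dec (parent u Fin.≟ v)

  child-irreflexive : ∀ {u} → ¬ ChildOf u u
  child-irreflexive {u} (u≢root , pu≡u) = <-irrefl (cong depth pu≡u) (parent-shallower u≢root)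

  tree : Graph m
  tree = record
    { adj    = λ u v → does (childOf? u v) ∨ does (childOf? v u)
    ; symm   = λ u v → Bool.∨-comm (does (childOf? u v)) _
    ; irrefl = λ u → cong₂ _∨_ (dec-false (childOf? u u) child-irreflexive)
                               (dec-false (childOf? u u) child-irreflexive) }

  child⇒adjacent : ∀ {u v} → ChildOf u v → Adj tree u v
  child⇒adjacent {u} {v} uv rewrite dec-true (childOf? u v) uv = refl

  adjacent⇒child : ∀ {u v} → Adj tree u v → ChildOf u v ⊎ ChildOf v u
  adjacent⇒child {u} {v} uv =
    Sum.map (does-true⇒ (childOf? u v)) (does-true⇒ (childOf? v u)) (∨-true (does (childOf? u v)) uv)

  path-to-root : ∀ d v → depth v < d → Star (Adj tree) v root
  path-to-root (suc d) v v<d with v Fin.≟ root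
  ... | yes refl    = ε
  ... | no v≢root = child⇒adjacent (v≢root , refl) ◅
                    path-to-root d (parent v) (≤-trans (parent-shallower v≢root) (s≤s⁻¹ v<d))

  connected : Connected tree
  connected u v = path-to-root _ u ≤-refl ◅◅ Star.reverse (λ {x} {y} → Adj-sym tree {x} {y}) (path-to-root _ v ≤-refl)

  shallow-neighbour-is-parent : ∀ {u v} → depth u ≤ depth v → Adj tree v u → parent v ≡ u
  shallow-neighbour-is-parent u≤v vu with adjacent⇒child vu
  ... | inj₁ (_ , pv≡u)        = pv≡u
  ... | inj₂ (u≢root , pu≡v) =
    contradiction (subst (λ w → depth w < depth _) pu≡v (parent-shallower u≢root)) (≤⇒≯ u≤v)

  no-two-shallow-neighbours : ∀ {v a b} → a ≢ b → depth a ≤ depth v → depth b ≤ depth v →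
                              Adj tree v a → Adj tree v b → ⊥
  no-two-shallow-neighbours a≢b a≤v b≤v va vb =
    a≢b (trans (sym (shallow-neighbour-is-parent a≤v va)) (shallow-neighbour-is-parent b≤v vb))

  -- On a cycle, the deepest vertex has two distinct neighbours.
  acyclic : ¬ HasCycle tree
  acyclic (k , c , c-injective , chain , close) =
    let (j , deepest) = deepest-position (depth ∘ c)
        (a , b , a≢b , ja , jb) = cycle-neighbours tree c chain close j
    in no-two-shallow-neighbours (a≢b ∘ c-injective) (deepest a) (deepest b) ja jb

  isTree : IsTree tree
  isTree = connected , acyclic

  hub-connected : (e : Subset m) (h : Fin m) → h ∈ e → (∀ {u} → u ∈ e → u ≢ h → ChildOf u h) →
                  InducedConnected tree e
  hub-connected e h h∈e children u v u∈e v∈e =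
    to-hub u∈e ◅◅ Star.reverse (λ {x} {y} (x∈ , y∈ , xy) → y∈ , x∈ , Adj-sym tree {x} {y} xy) (to-hub v∈e)
    where
    to-hub : ∀ {u} → u ∈ e → Star (InducedAdj tree e) u h
    to-hub {u} u∈e with u Fin.≟ h
    ... | yes refl = ε
    ... | no u≢h   = (u∈e , h∈e , child⇒adjacent (children u∈e u≢h)) ◅ ε

filter-≤1 : ∀ {A : Set} {P : Pred A 0ℓ} (P? : Decidable P) {xs : List A} →
            AllPairs (λ x y → ¬ (P x × P y)) xs → length (filter P? xs) ≤ 1
filter-≤1 P? []                       = z≤n
filter-≤1 P? {x ∷ xs} (x-excl ∷ rest) with P? x
... | yes px = s≤s (≤-reflexive (cong length (filter-none P? (All.map (λ excl py → excl (px , py)) x-excl))))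
... | no _   = filter-≤1 P? rest

module Family {K : Set} (_≟ᴷ_ : DecidableEquality K) {m} (edge : K → Subset m)
              {r} (2≤r : 2 ≤ r) (∣edge∣ : ∀ κ → ∣ edge κ ∣ ≡ r) (c : Fin m)
              (meet : ∀ {κ κ′} → κ ≢ κ′ → ∀ {v} → v ∈ edge κ → v ∈ edge κ′ → v ≡ c)
              (kinds : List K) (kinds-unique : Unique kinds) where

  -- distinct members are incomparable: the smaller one would lie inside {c}
  edge-⊈ : ∀ {κ κ′} → κ ≢ κ′ → ¬ (edge κ ⊆ edge κ′)
  edge-⊈ {κ} κ≢κ′ ⊆′ = <⇒≱ 2≤r (subst (_≤ 1) (∣edge∣ κ) (∣p∣≤1 (edge κ) at-c))
    where
    at-c : ∀ {i j} → i ∈ edge κ → j ∈ edge κ → i ≡ j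
    at-c i∈ j∈ = trans (meet κ≢κ′ i∈ (⊆′ i∈)) (sym (meet κ≢κ′ j∈ (⊆′ j∈)))

  edge-injective : ∀ {κ κ′} → edge κ ≡ edge κ′ → κ ≡ κ′
  edge-injective {κ} {κ′} eq with κ ≟ᴷ κ′
  ... | yes κ≡κ′ = κ≡κ′
  ... | no κ≢κ′  = contradiction (λ {i} i∈ → subst (i ∈_) eq i∈) (edge-⊈ κ≢κ′)

  edge-of : ∀ {e} → e LM.∈ map edge kinds → ∃[ κ ] e ≡ edge κ
  edge-of e∈ = let (κ , _ , e≡) = ∈-map⁻ edge e∈ in κ , e≡

  listed-size : ∀ {e} → e LM.∈ map edge kinds → ∣ e ∣ ≡ r
  listed-size e∈ = let (κ , e≡) = edge-of e∈ in trans (cong ∣_∣ e≡) (∣edge∣ κ)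

  hypergraph : Hypergraph
  hypergraph = record
    { n      = m
    ; edges  = map edge kinds
    ; nodup  = Unique.map⁺ edge-injective kinds-unique
    ; simple = λ e∈ e′∈ ⊆′ → incomparable (edge-of e∈) (edge-of e′∈) ⊆′
    ; noLoop = λ e∈ → subst (2 ≤_) (sym (listed-size e∈)) 2≤r }
    where
    incomparable : ∀ {e e′} → ∃[ κ ] e ≡ edge κ → ∃[ κ′ ] e′ ≡ edge κ′ → e ⊆ e′ → e ≡ e′
    incomparable (κ , refl) (κ′ , refl) ⊆′ with κ ≟ᴷ κ′
    ... | yes refl   = refl
    ... | no κ≢κ′    = ⊥-elim (edge-⊈ κ≢κ′ ⊆′)

  uniform : Uniform r hypergraph
  uniform = listed-size

  linear : Linear hypergraph
  linear e∈ e′∈ e≢e′ with edge-of e∈ | edge-of e′∈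
  ... | κ , refl | κ′ , refl = ∣p∣≤1 (edge κ ∩ edge κ′) λ i∈ j∈ → trans (at-c i∈) (sym (at-c j∈))
    where
    at-c : ∀ {i} → i ∈ edge κ ∩ edge κ′ → i ≡ c
    at-c i∈ = let (i∈κ , i∈κ′) = x∈p∩q⁻ (edge κ) (edge κ′) i∈
              in meet (λ { refl → e≢e′ refl }) i∈κ i∈κ′

  degree≤1 : ∀ {v} → v ≢ c → degree hypergraph v ≤ 1
  degree≤1 v≢c = filter-≤1 (_ ∈?_) (AllPairs.map⁺ (AllPairs.map not-both kinds-unique))
    where
    not-both : ∀ {κ κ′} → κ ≢ κ′ → ¬ (_ ∈ edge κ × _ ∈ edge κ′)
    not-both κ≢κ′ (v∈ , v∈′) = v≢c (meet κ≢κ′ v∈ v∈′)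

maxDegree-attained : (H : Hypergraph) {s : ℕ} (c : Fin (n H)) →
                     degree H c ≡ s → (∀ v → degree H v ≤ s) → maxDegree H ≡ s
maxDegree-attained H {s} c deg-c bounded = ≤-antisym upper lower
  where
  upper : maxDegree H ≤ s
  upper = foldr-preservesᵇ {P = _≤ s} ⊔-lub z≤n (All.map⁺ {f = degree H} (All.universal bounded (allFin (n H))))

  lower : s ≤ maxDegree H
  lower = foldr-preservesᵒ ⊔-above 0 _ (inj₂ (Any.map⁺ (Any.map (λ { refl → ≤-reflexive (sym deg-c) }) (∈-allFin c))))
    where
    ⊔-above : ∀ x y → s ≤ x ⊎ s ≤ y → s ≤ x ⊔ y
    ⊔-above x y (inj₁ s≤x) = ≤-trans s≤x (m≤m⊔n x y)
    ⊔-above x y (inj₂ s≤y) = ≤-trans s≤y (m≤n⊔m x y)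

-- Vertices are the numbers below N:
--   0 (the centre), the left side 1 … r, the right side r+1 … 2r, and s blocks of k vertices.
module Construction (k s : ℕ) (1≤k : 1 ≤ k) (1≤s : 1 ≤ s) (s≤2r : s ≤ suc k + suc k) where

  r : ℕ
  r = suc k

  start : ℕ → ℕ
  start t = suc (r + r + t * k)

  N : ℕ
  N = suc (r + r + s * k)

  Left Right : Pred ℕ 0ℓ
  Left  = In 1 r
  Right = In (suc r) r

  Block : ℕ → Pred ℕ 0ℓ
  Block t = In (start t) k

  -- S_t; for t ≥ s there is no block t and S_t = {0}
  Petal : ℕ → Pred ℕ 0ℓ
  Petal t x = x ≡ 0 ⊎ (t < s × Block t x)

  Points : ℕ → ℕ → Set
  Points u v = (Left u × Petal (pred u) v) ⊎ (Right v × Petal (pred v) u)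

  left? : Decidable Left
  left? = in? 1 r

  right? : Decidable Right
  right? = in? (suc r) r

  petal? : ∀ t → Decidable (Petal t)
  petal? t x = x ≟ 0 ⊎-dec (t <? s ×-dec in? (start t) k x)

  points? : ∀ u v → Dec (Points u v)
  points? u v = (left? u ×-dec petal? (pred u) v) ⊎-dec (right? v ×-dec petal? (pred v) u)

  start-mono : ∀ {t t′} → t < t′ → start t + k ≤ start t′
  start-mono {t} {t′} t<t′ = s≤s (begin
    r + r + t * k + k   ≡⟨ +-assoc (r + r) (t * k) k ⟩
    r + r + (t * k + k) ≡⟨ cong (r + r +_) (+-comm (t * k) k) ⟩
    r + r + suc t * k   ≤⟨ +-monoʳ-≤ (r + r) (*-monoˡ-≤ k t<t′) ⟩
    r + r + t′ * k      ∎)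
    where open ≤-Reasoning

  left-right : ∀ {x} → Left x → ¬ Right x
  left-right = In-disjoint ≤-refl

  left-block : ∀ {t x} → Left x → ¬ Block t x
  left-block = In-disjoint (s≤s (≤-trans (m≤m+n r r) (m≤m+n (r + r) _)))

  right-block : ∀ {t x} → Right x → ¬ Block t x
  right-block = In-disjoint (s≤s (m≤m+n (r + r) _))

  block-unique : ∀ {t t′ x} → Block t x → Block t′ x → t ≡ t′
  block-unique {t} {t′} x∈t x∈t′ with <-cmp t t′
  ... | tri< t<t′ _ _ = contradiction x∈t′ (In-disjoint (start-mono t<t′) x∈t)
  ... | tri≈ _ t≡t′ _ = t≡t′
  ... | tri> _ _ t′<t = contradiction x∈t (In-disjoint (start-mono t′<t) x∈t′)

  petal-not-left : ∀ {t x} → Petal t x → ¬ Left x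
  petal-not-left (inj₁ refl)     = λ 0-left → In-positive 0-left refl
  petal-not-left {t} (inj₂ (_ , x∈)) = λ x-left → left-block {t} x-left x∈

  petal-not-right : ∀ {t x} → Petal t x → ¬ Right x
  petal-not-right (inj₁ refl)     = λ 0-right → In-positive 0-right refl
  petal-not-right {t} (inj₂ (_ , x∈)) = λ x-right → right-block {t} x-right x∈

  in-centre : ∀ u → Points u 0 ⇔ Left u
  in-centre u = mk⇔ (λ { (inj₁ (u-left , _))  → u-left
                         ; (inj₂ (0-right , _)) → contradiction refl (In-positive 0-right) })
                    (λ u-left → inj₁ (u-left , inj₁ refl))

  out-centre : ∀ v → Points 0 v ⇔ Right v
  out-centre v = mk⇔ (λ { (inj₁ (0-left , _))  → contradiction refl (In-positive 0-left)
                          ; (inj₂ (v-right , _)) → v-right })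
                     (λ v-right → inj₂ (v-right , inj₁ refl))

  in-left : ∀ {w} → Left w → ∀ u → ¬ Points u w
  in-left w-left u (inj₁ (_ , w∈)) = petal-not-left w∈ w-left
  in-left w-left u (inj₂ (w-right , _)) = left-right w-left w-right

  out-left : ∀ {w} → Left w → ∀ v → Points w v ⇔ Petal (pred w) v
  out-left w-left v = mk⇔ (λ { (inj₁ (_ , v∈)) → v∈
                              ; (inj₂ (_ , w∈)) → contradiction w-left (petal-not-left w∈) })
                          (λ v∈ → inj₁ (w-left , v∈))

  in-right : ∀ {w} → Right w → ∀ u → Points u w ⇔ Petal (pred w) u
  in-right w-right u = mk⇔ (λ { (inj₁ (_ , w∈)) → contradiction w-right (petal-not-right w∈)
                               ; (inj₂ (_ , u∈)) → u∈ })
                           (λ u∈ → inj₂ (w-right , u∈))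

  out-right : ∀ {w} → Right w → ∀ v → ¬ Points w v
  out-right w-right v (inj₁ (w-left , _)) = left-right w-left w-right
  out-right w-right v (inj₂ (_ , w∈)) = petal-not-right w∈ w-right

  petal-block : ∀ {t t′ w} → Block t w → Petal t′ w → t′ ≡ t
  petal-block w∈ (inj₁ refl)      = contradiction refl (In-positive w∈)
  petal-block w∈ (inj₂ (_ , w∈′)) = block-unique w∈′ w∈

  pred≡⇒ : ∀ {u t} → 1 ≤ u → pred u ≡ t → u ≡ suc t
  pred≡⇒ (s≤s _) refl = refl

  in-block : ∀ {t w} → Block t w → ∀ {u} → Points u w → u ≡ suc t
  in-block w∈ (inj₁ ((1≤u , _) , w∈′)) = pred≡⇒ 1≤u (petal-block w∈ w∈′)
  in-block {t} w∈ (inj₂ (w-right , _)) = contradiction w∈ (right-block {t} w-right)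

  out-block : ∀ {t w} → Block t w → ∀ {v} → Points w v → v ≡ suc t
  out-block {t} w∈ (inj₁ (w-left , _)) = contradiction w∈ (left-block {t} w-left)
  out-block w∈ (inj₂ ((1≤v , _) , w∈′)) = pred≡⇒ (≤-trans (s≤s z≤n) 1≤v) (petal-block w∈ w∈′)

  block-position : ∀ {y} → y < s * k → ∃[ t ] (t < s × Block t (suc (r + r) + y))
  block-position {y} y<sk with block-of k s y<sk
  ... | t , t<s , tk≤y , y<tk+k = t , t<s , s≤s (+-monoʳ-≤ (r + r) tk≤y) ,
        s≤s (subst (r + r + y <_) (sym (+-assoc (r + r) (t * k) k)) (+-monoʳ-< (r + r) y<tk+k))

  in-blocks : ∀ {x} → r + r < x → x < N → ∃[ t ] (t < s × Block t x)
  in-blocks {x} 2r<x x<N = subst (λ z → ∃[ t ] (t < s × Block t z)) x≡ (block-position y<sk)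
    where
    x≡ : suc (r + r) + (x ∸ suc (r + r)) ≡ x
    x≡ = m+[n∸m]≡n 2r<x
    y<sk : x ∸ suc (r + r) < s * k
    y<sk = +-cancelˡ-< (suc (r + r)) _ (s * k) (subst (_< N) (sym x≡) x<N)

  classify : ∀ w → w < N → w ≡ 0 ⊎ Left w ⊎ Right w ⊎ ∃[ t ] (t < s × Block t w)
  classify zero    _   = inj₁ refl
  classify (suc w) w<N with suc w ≤? r | suc w ≤? r + r
  ... | yes w≤r | _          = inj₂ (inj₁ (s≤s z≤n , s≤s w≤r))
  ... | no w≰r  | yes w≤2r   = inj₂ (inj₂ (inj₁ (≰⇒> w≰r , s≤s w≤2r)))
  ... | no _    | no w≰2r    = inj₂ (inj₂ (inj₂ (in-blocks (≰⇒> w≰2r) w<N)))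

  -- Arcs go from the left side to the middle or from the middle to the right side.
  level : ℕ → ℕ
  level x = if does (left? x) then 0 else if does (right? x) then 2 else 1

  level-left : ∀ {x} → Left x → level x ≡ 0
  level-left {x} x-left rewrite dec-true (left? x) x-left = refl

  level-right : ∀ {x} → Right x → level x ≡ 2
  level-right {x} x-right
    rewrite dec-false (left? x) (λ x-left → left-right x-left x-right) | dec-true (right? x) x-right = refl

  level-petal : ∀ {t x} → Petal t x → level x ≡ 1
  level-petal {x = x} x∈
    rewrite dec-false (left? x) (petal-not-left x∈) | dec-false (right? x) (petal-not-right x∈) = refl

  points-raise-level : ∀ {u v} → Points u v → level u < level v
  points-raise-level (inj₁ (u-left , v∈)) rewrite level-left u-left | level-petal v∈ = s≤s z≤n
  points-raise-level (inj₂ (v-right , u∈)) rewrite level-petal u∈ | level-right v-right = s≤s (s≤s z≤n)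

  module D = Ranked {N + 0} (λ u v → does (points? (toℕ u) (toℕ v))) (level ∘ toℕ)
                    (λ {u} {v} uv → points-raise-level (does-true⇒ (points? (toℕ u) (toℕ v)) uv))

  data Kind : Set where
    left right : Kind
    petal      : Fin s → Kind

  _≟ᴷ_ : DecidableEquality Kind
  left    ≟ᴷ left     = yes refl
  left    ≟ᴷ right    = no λ ()
  left    ≟ᴷ petal _  = no λ ()
  right   ≟ᴷ left     = no λ ()
  right   ≟ᴷ right    = yes refl
  right   ≟ᴷ petal _  = no λ ()
  petal _ ≟ᴷ left     = no λ ()
  petal _ ≟ᴷ right    = no λ ()
  petal t ≟ᴷ petal t′ with t Fin.≟ t′
  ... | yes refl = yes refl
  ... | no t≢t′  = no λ { refl → t≢t′ refl }

  Member : Kind → Pred ℕ 0ℓ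
  Member left      = Left
  Member right     = Right
  Member (petal t) = Petal (toℕ t)

  member? : ∀ κ → Decidable (Member κ)
  member? left      = left?
  member? right     = right?
  member? (petal t) = petal? (toℕ t)

  edge : Kind → Subset N
  edge κ = subsetOf N (member? κ)

  kinds : List Kind
  kinds = left ∷ right ∷ map petal (allFin s)

  kinds-unique : Unique kinds
  kinds-unique = ((λ ()) All.∷ All.map⁺ (All.universal (λ _ ()) _))
               ∷ All.map⁺ (All.universal (λ _ ()) _)
               ∷ Unique.map⁺ (λ { refl → refl }) (Unique.allFin⁺ s)

  ∈kinds : ∀ κ → κ LM.∈ kinds
  ∈kinds left      = here refl
  ∈kinds right     = there (here refl)
  ∈kinds (petal t) = there (there (∈-map⁺ petal (∈-allFin t)))

  petal-shift : ∀ {t} → t < s → ∀ x → Petal t (suc x) ⇔ In (r + r + t * k) k x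
  petal-shift t<s x = mk⇔ (λ { (inj₁ ()) ; (inj₂ (_ , x∈)) → Equivalence.to In-suc x∈ })
                          (λ x∈ → inj₂ (t<s , Equivalence.from In-suc x∈))

  ∣edge∣ : ∀ κ → ∣ edge κ ∣ ≡ r
  ∣edge∣ left  = ∣interval∣ N 1 r (s≤s (≤-trans (m≤m+n r r) (m≤m+n (r + r) _)))
  ∣edge∣ right = ∣interval∣ N (suc r) r (s≤s (m≤m+n (r + r) _))
  ∣edge∣ (petal t) = begin
    ∣ subsetOf N (petal? (toℕ t)) ∣
      ≡⟨ ∣subsetOf∣-yes (petal? (toℕ t)) M (inj₁ refl) ⟩
    suc ∣ subsetOf M (λ x → petal? (toℕ t) (suc x)) ∣
      ≡⟨ cong (suc ∘ ∣_∣) (subsetOf-cong M (λ x → petal? (toℕ t) (suc x)) (in? (r + r + toℕ t * k) k) (petal-shift t<s)) ⟩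
    suc ∣ subsetOf M (in? (r + r + toℕ t * k) k) ∣
      ≡⟨ cong suc (∣interval∣ M (r + r + toℕ t * k) k (s≤s⁻¹ (start-mono t<s))) ⟩
    suc k ∎
    where
    open ≡-Reasoning
    M : ℕ
    M = r + r + s * k
    t<s : toℕ t < s
    t<s = Fin.toℕ<n t

  members-meet : ∀ {κ κ′ x} → κ ≢ κ′ → Member κ x → Member κ′ x → x ≡ 0
  members-meet {left}    {left}     κ≢κ′ _ _ = contradiction refl κ≢κ′
  members-meet {left}    {right}    _ x-left x-right = contradiction x-right (left-right x-left)
  members-meet {left}    {petal _}  _ x-left x∈ = contradiction x-left (petal-not-left x∈)
  members-meet {right}   {left}     _ x-right x-left = contradiction x-right (left-right x-left)
  members-meet {right}   {right}    κ≢κ′ _ _ = contradiction refl κ≢κ′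
  members-meet {right}   {petal _}  _ x-right x∈ = contradiction x-right (petal-not-right x∈)
  members-meet {petal _} {left}     _ x∈ x-left = contradiction x-left (petal-not-left x∈)
  members-meet {petal _} {right}    _ x∈ x-right = contradiction x-right (petal-not-right x∈)
  members-meet {petal t} {petal t′} κ≢κ′ (inj₁ x≡0) _ = x≡0
  members-meet {petal t} {petal t′} κ≢κ′ (inj₂ _) (inj₁ x≡0) = x≡0
  members-meet {petal t} {petal t′} κ≢κ′ (inj₂ (_ , x∈)) (inj₂ (_ , x∈′)) =
    contradiction (cong petal (toℕ-injective (block-unique x∈ x∈′))) κ≢κ′

  edges-meet : ∀ {κ κ′} → κ ≢ κ′ → ∀ {v} → v ∈ edge κ → v ∈ edge κ′ → v ≡ zero
  edges-meet {κ} {κ′} κ≢κ′ v∈ v∈′ =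
    toℕ-injective (members-meet κ≢κ′ (∈subsetOf⁻ (member? κ) v∈) (∈subsetOf⁻ (member? κ′) v∈′))

  open Family _≟ᴷ_ edge (s≤s 1≤k) ∣edge∣ zero edges-meet kinds kinds-unique public
    renaming (hypergraph to H)

  degree-centre : degree H zero ≡ s
  degree-centre = begin
    length (filter (zero ∈?_) (edge left ∷ edge right ∷ petals))
      ≡⟨ cong length (filter-reject (zero ∈?_) {xs = edge right ∷ petals} 0∉left) ⟩
    length (filter (zero ∈?_) (edge right ∷ petals))
      ≡⟨ cong length (filter-reject (zero ∈?_) {xs = petals} 0∉right) ⟩
    length (filter (zero ∈?_) petals)
      ≡⟨ cong length (filter-all (zero ∈?_) {xs = petals} (All.map⁺ (All.map⁺ (All.universal centre∈ (allFin s))))) ⟩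
    length petals
      ≡⟨ trans (length-map edge (map petal (allFin s))) (trans (length-map petal (allFin s)) (length-tabulate {n = s} id)) ⟩
    s ∎
    where
    open ≡-Reasoning
    petals : List (Subset N)
    petals = map edge (map petal (allFin s))
    0∉left : ¬ zero ∈ edge left
    0∉left 0∈ = In-positive (∈subsetOf⁻ left? 0∈) refl
    0∉right : ¬ zero ∈ edge right
    0∉right 0∈ = In-positive (∈subsetOf⁻ right? 0∈) refl
    centre∈ : ∀ t → zero ∈ edge (petal t)
    centre∈ t = ∈subsetOf⁺ (petal? (toℕ t)) (inj₁ refl)

  maxDegree≡s : maxDegree H ≡ s
  maxDegree≡s = maxDegree-attained H zero degree-centre bounded
    where
    bounded : ∀ v → degree H v ≤ s
    bounded v with v Fin.≟ zero
    ... | yes refl  = ≤-reflexive degree-centre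
    ... | no v≢zero = ≤-trans (degree≤1 v≢zero) 1≤s

  LeftLeaf RightLeaf : Pred ℕ 0ℓ
  LeftLeaf  = In 2 k
  RightLeaf = In (suc (suc r)) k

  leftLeaf? : Decidable LeftLeaf
  leftLeaf? = in? 2 k

  rightLeaf? : Decidable RightLeaf
  rightLeaf? = in? (suc (suc r)) k

  leftLeaf⇒left : ∀ {x} → LeftLeaf x → Left x
  leftLeaf⇒left (2≤x , x<) = ≤-trans (s≤s z≤n) 2≤x , x<

  rightLeaf⇒right : ∀ {x} → RightLeaf x → Right x
  rightLeaf⇒right {x} (r+2≤x , x<) = ≤-trans (n≤1+n (suc r)) r+2≤x , subst (x <_) (sym (cong suc (+-suc r k))) x<

  parentℕ : ℕ → ℕ
  parentℕ x = if does (leftLeaf? x) then 1 else if does (rightLeaf? x) then suc r else 0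

  depthℕ : ℕ → ℕ
  depthℕ zero    = 0
  depthℕ (suc x) = if does (leftLeaf? (suc x) ⊎-dec rightLeaf? (suc x)) then 2 else 1

  parent-leftLeaf : ∀ {x} → LeftLeaf x → parentℕ x ≡ 1
  parent-leftLeaf {x} x-leaf rewrite dec-true (leftLeaf? x) x-leaf = refl

  parent-rightLeaf : ∀ {x} → RightLeaf x → parentℕ x ≡ suc r
  parent-rightLeaf {x} x-leaf
    rewrite dec-false (leftLeaf? x) (λ x-leaf′ → left-right (leftLeaf⇒left x-leaf′) (rightLeaf⇒right x-leaf))
          | dec-true (rightLeaf? x) x-leaf = refl

  parent-inner : ∀ {x} → ¬ LeftLeaf x → ¬ RightLeaf x → parentℕ x ≡ 0
  parent-inner {x} ¬left ¬right rewrite dec-false (leftLeaf? x) ¬left | dec-false (rightLeaf? x) ¬right = refl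

  depth-leaf : ∀ {x} → LeftLeaf x ⊎ RightLeaf x → depthℕ x ≡ 2
  depth-leaf {suc x} x-leaf rewrite dec-true (leftLeaf? (suc x) ⊎-dec rightLeaf? (suc x)) x-leaf = refl
  depth-leaf {zero} (inj₁ (() , _))
  depth-leaf {zero} (inj₂ (() , _))

  depth-inner : ∀ {x} → x ≢ 0 → ¬ (LeftLeaf x ⊎ RightLeaf x) → depthℕ x ≡ 1
  depth-inner {zero}  x≢0 _       = contradiction refl x≢0
  depth-inner {suc x} _   ¬leaf rewrite dec-false (leftLeaf? (suc x) ⊎-dec rightLeaf? (suc x)) ¬leaf = refl

  hub-not-leaf : ∀ {x} → x ≡ 1 ⊎ x ≡ suc r → ¬ (LeftLeaf x ⊎ RightLeaf x)
  hub-not-leaf (inj₁ refl) (inj₁ (s≤s () , _))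
  hub-not-leaf (inj₁ refl) (inj₂ (s≤s () , _))
  hub-not-leaf (inj₂ refl) (inj₁ (_ , r+1<r+1)) = <-irrefl refl r+1<r+1
  hub-not-leaf (inj₂ refl) (inj₂ (r+2≤r+1 , _)) = <-irrefl refl r+2≤r+1

  parentℕ-shallower : ∀ {x} → x ≢ 0 → depthℕ (parentℕ x) < depthℕ x
  parentℕ-shallower {x} x≢0 with leftLeaf? x | rightLeaf? x
  ... | yes x-leaf | _ rewrite parent-leftLeaf x-leaf | depth-leaf (inj₁ x-leaf)
      | depth-inner {1} (λ ()) (hub-not-leaf (inj₁ refl)) = ≤-refl
  ... | no _ | yes x-leaf rewrite parent-rightLeaf x-leaf | depth-leaf (inj₂ x-leaf)
      | depth-inner {suc r} (λ ()) (hub-not-leaf (inj₂ refl)) = ≤-refl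
  ... | no ¬left | no ¬right rewrite parent-inner ¬left ¬right
      | depth-inner x≢0 Sum.[ ¬left , ¬right ] = s≤s z≤n

  ≤r+1⇒<N : ∀ {x} → x ≤ suc r → x < N
  ≤r+1⇒<N {x} x≤ = s≤s (begin
    x               ≤⟨ x≤ ⟩
    suc r           ≤⟨ m≤m+n (suc r) k ⟩
    suc r + k       ≡⟨ +-suc r k ⟨
    r + r           ≤⟨ m≤m+n (r + r) (s * k) ⟩
    r + r + s * k   ∎)
    where open ≤-Reasoning

  parentℕ<N : ∀ x → parentℕ x < N
  parentℕ<N x = ≤r+1⇒<N (parentℕ≤ x)
    where
    parentℕ≤ : ∀ x → parentℕ x ≤ suc r
    parentℕ≤ x with does (leftLeaf? x) | does (rightLeaf? x)
    ... | true  | _     = s≤s z≤n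
    ... | false | true  = ≤-refl
    ... | false | false = z≤n

  module T = ParentTree {N} zero (λ v → fromℕ< (parentℕ<N (toℕ v))) (depthℕ ∘ toℕ)
               (λ {v} v≢0 → subst (λ p → depthℕ p < depthℕ (toℕ v)) (sym (toℕ-fromℕ< (parentℕ<N (toℕ v))))
                                   (parentℕ-shallower (λ v≡0 → v≢0 (toℕ-injective v≡0))))

  -- Each hyperedge is a star of the tree around its hub.
  hubℕ : Kind → ℕ
  hubℕ left      = 1
  hubℕ right     = suc r
  hubℕ (petal _) = 0

  hub-member : ∀ κ → Member κ (hubℕ κ)
  hub-member left      = ≤-refl , s≤s (s≤s z≤n)
  hub-member right     = ≤-refl , m<m+n (suc r) (s≤s z≤n)
  hub-member (petal _) = inj₁ refl

  hub-parent : ∀ κ {x} → Member κ x → x ≢ hubℕ κ → x ≢ 0 × parentℕ x ≡ hubℕ κ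
  hub-parent left  {x} x-left@(1≤x , x<) x≢1 =
    In-positive x-left , parent-leftLeaf (≤∧≢⇒< 1≤x (x≢1 ∘ sym) , x<)
  hub-parent right {x} x-right@(r+1≤x , x<) x≢r+1 =
    In-positive x-right , parent-rightLeaf (≤∧≢⇒< r+1≤x (x≢r+1 ∘ sym) , subst (x <_) (cong suc (+-suc r k)) x<)
  hub-parent (petal t) (inj₁ x≡0) x≢0 = contradiction x≡0 x≢0
  hub-parent (petal t) {x} (inj₂ (_ , x∈)) _ =
    In-positive x∈ , parent-inner (λ leaf → left-block {toℕ t} (leftLeaf⇒left leaf) x∈)
                                  (λ leaf → right-block {toℕ t} (rightLeaf⇒right leaf) x∈)

  hub : Kind → Fin N
  hub κ = fromℕ< (≤r+1⇒<N (hub≤ κ))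
    where
    hub≤ : ∀ κ → hubℕ κ ≤ suc r
    hub≤ left      = s≤s z≤n
    hub≤ right     = ≤-refl
    hub≤ (petal _) = z≤n

  toℕ-hub : ∀ κ → toℕ (hub κ) ≡ hubℕ κ
  toℕ-hub κ = toℕ-fromℕ< _

  hub∈ : ∀ κ → hub κ ∈ edge κ
  hub∈ κ = ∈subsetOf⁺ (member? κ) (subst (Member κ) (sym (toℕ-hub κ)) (hub-member κ))

  hub-children : ∀ κ {u} → u ∈ edge κ → u ≢ hub κ → T.ChildOf u (hub κ)
  hub-children κ {u} u∈ u≢hub
    with hub-parent κ (∈subsetOf⁻ (member? κ) u∈) (λ u≡ → u≢hub (toℕ-injective (trans u≡ (sym (toℕ-hub κ)))))
  ... | u≢0 , parent≡ =
    (λ { refl → u≢0 refl }) , toℕ-injective (trans (toℕ-fromℕ< _) (trans parent≡ (sym (toℕ-hub κ))))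

  hypertree : IsHypertree H
  hypertree = T.tree , T.isTree , λ e∈ → let (κ , e≡) = edge-of e∈ in
    subst (InducedConnected T.tree) (sym e≡) (T.hub-connected (edge κ) (hub κ) (hub∈ κ) (hub-children κ))

  pad-edge : ∀ κ {P : Pred ℕ 0ℓ} (P? : Decidable P) → (∀ x → P x ⇔ Member κ x) →
             pad (edge κ) ≡ subsetOf (N + 0) P?
  pad-edge κ P? P⇔ = trans (subsetOf-pad N (member? κ)) (sym (subsetOf-cong (N + 0) P? (member? κ) P⇔))

  edge-harmless : ∀ κ {P : Pred ℕ 0ℓ} (P? : Decidable P) → (∀ x → P x ⇔ Member κ x) →
                  Harmless H (subsetOf (N + 0) P?)
  edge-harmless κ P? P⇔ = inj₂ (edge κ , ∈-map⁺ edge (∈kinds κ) , sym (pad-edge κ P? P⇔))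

  small-harmless : ∀ {P : Pred ℕ 0ℓ} (P? : Decidable P) {c} → (∀ {x} → P x → x ≡ c) →
                   Harmless H (subsetOf (N + 0) P?)
  small-harmless P? only = inj₁ (∣subsetOf∣≤1 (N + 0) P? only)

  -- S_t is a hyperedge when t < s and has the single vertex 0 otherwise
  petal-harmless : ∀ t {P : Pred ℕ 0ℓ} (P? : Decidable P) → (∀ x → P x ⇔ Petal t x) →
                   Harmless H (subsetOf (N + 0) P?)
  petal-harmless t {P} P? P⇔ with t <? s
  ... | yes t<s = edge-harmless (petal (fromℕ< t<s)) P?
                    (λ x → subst (λ t′ → P x ⇔ Petal t′ x) (sym (toℕ-fromℕ< t<s)) (P⇔ x))
  ... | no t≮s  = small-harmless P? λ Px → petal-beyond t≮s (Equivalence.to (P⇔ _) Px)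
    where
    petal-beyond : ∀ {t x} → ¬ t < s → Petal t x → x ≡ 0
    petal-beyond _   (inj₁ x≡0)     = x≡0
    petal-beyond t≮s (inj₂ (t<s , _)) = contradiction t<s t≮s

  into? : ∀ w → Decidable (λ u → Points u w)
  into? w u = points? u w

  from? : ∀ w → Decidable (Points w)
  from? w = points? w

  vertex<N : ∀ (v : Fin (N + 0)) → toℕ v < N
  vertex<N v = subst (toℕ v <_) (+-identityʳ N) (Fin.toℕ<n v)

  in-harmless : ∀ v → Harmless H (inNbhd D.digraph v)
  in-harmless v with classify (toℕ v) (vertex<N v)
  ... | inj₁ v≡0 =
    edge-harmless left (into? (toℕ v)) λ x → subst (λ w → Points x w ⇔ Left x) (sym v≡0) (in-centre x)
  ... | inj₂ (inj₁ v-left)               = small-harmless (into? (toℕ v)) {0} λ x→v → contradiction x→v (in-left v-left _)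
  ... | inj₂ (inj₂ (inj₁ v-right))       = petal-harmless _ (into? (toℕ v)) (in-right v-right)
  ... | inj₂ (inj₂ (inj₂ (t , _ , v∈))) = small-harmless (into? (toℕ v)) (in-block {t} v∈)

  out-harmless : ∀ v → Harmless H (outNbhd D.digraph v)
  out-harmless v with classify (toℕ v) (vertex<N v)
  ... | inj₁ v≡0 =
    edge-harmless right (from? (toℕ v)) λ x → subst (λ w → Points w x ⇔ Right x) (sym v≡0) (out-centre x)
  ... | inj₂ (inj₁ v-left)               = petal-harmless _ (from? (toℕ v)) (out-left v-left)
  ... | inj₂ (inj₂ (inj₁ v-right))       = small-harmless (from? (toℕ v)) {0} λ v→x → contradiction v→x (out-right v-right _)
  ... | inj₂ (inj₂ (inj₂ (t , _ , v∈))) = small-harmless (from? (toℕ v)) (out-block {t} v∈)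

  vertex : ∀ {w} → w < N → Fin (N + 0)
  vertex {w} w<N = fromℕ< (subst (w <_) (sym (+-identityʳ N)) w<N)

  toℕ-vertex : ∀ {w} (w<N : w < N) → toℕ (vertex w<N) ≡ w
  toℕ-vertex {w} w<N = toℕ-fromℕ< (subst (w <_) (sym (+-identityʳ N)) w<N)

  in-vertex : ∀ {w} (w<N : w < N) → inNbhd D.digraph (vertex w<N) ≡ subsetOf (N + 0) (into? w)
  in-vertex w<N rewrite toℕ-vertex w<N = refl

  out-vertex : ∀ {w} (w<N : w < N) → outNbhd D.digraph (vertex w<N) ≡ subsetOf (N + 0) (from? w)
  out-vertex w<N rewrite toℕ-vertex w<N = refl

  owner-side : ∀ {t} → t < s → Left (suc t) ⊎ Right (suc t)
  owner-side {t} t<s with suc t ≤? r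
  ... | yes t<r = inj₁ (s≤s z≤n , s≤s t<r)
  ... | no t≮r  = inj₂ (≰⇒> t≮r , s≤s (≤-trans t<s s≤2r))

  owner<N : ∀ {t} → t < s → suc t < N
  owner<N t<s = s≤s (≤-trans (≤-trans t<s s≤2r) (m≤m+n (r + r) _))

  realised : ∀ {e₀} → e₀ LM.∈ edges H → ∃[ v ] (pad e₀ ≡ inNbhd D.digraph v ⊎ pad e₀ ≡ outNbhd D.digraph v)
  realised e₀∈ with edge-of e₀∈
  ... | left  , refl = zero , inj₁ (pad-edge left (into? 0) in-centre)
  ... | right , refl = zero , inj₂ (pad-edge right (from? 0) out-centre)
  ... | petal t , refl with Fin.toℕ<n t
  ... | t<s with owner-side t<s
  ... | inj₁ owner-left  =
    vertex (owner<N t<s) , inj₂ (trans (pad-edge (petal t) (from? (suc (toℕ t))) (out-left owner-left))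
                                       (sym (out-vertex (owner<N t<s))))
  ... | inj₂ owner-right =
    vertex (owner<N t<s) , inj₁ (trans (pad-edge (petal t) (into? (suc (toℕ t))) (in-right owner-right))
                                       (sym (in-vertex (owner<N t<s))))

  nicheNumberZero : NicheNumberZero H
  nicheNumberZero = nicheNumberZero-intro H D.digraph D.acyclic in-harmless out-harmless realised

theorem1p3 : (r s : ℕ) → 3 ≤ r → 3 ≤ s → s ≤ 2 * r →
    Σ Hypergraph λ H →
      Uniform r H × Linear H × IsHypertree H ×
      maxDegree H ≡ s × NicheNumberZero H
theorem1p3 (suc k) s 3≤r 3≤s s≤2r =
  H , uniform , linear , hypertree , maxDegree≡s , nicheNumberZero
  where
  1≤k : 1 ≤ k
  1≤k = s≤s⁻¹ (≤-trans (s≤s (s≤s z≤n)) 3≤r)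
  1≤s : 1 ≤ s
  1≤s = ≤-trans (s≤s z≤n) 3≤s
  s≤r+r : s ≤ suc k + suc k
  s≤r+r = subst (s ≤_) (cong (suc k +_) (+-identityʳ (suc k))) s≤2r
  open Construction k s 1≤k 1≤s s≤r+r
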